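{- Let $\mathcal{P}$ be a set of three pairwise edge-disjoint paths in $\mathrm{XCH}$, no two of which cross at any vertex other than $a,b,c,d$, such that for some $S''\in\{\{s'_1,s'_2\},\{s'_3,s'_4\}\}$, $\mathcal{P}$ contains exactly two $(\{s_1,s_2\},S'')$-paths, and $\mathcal{P}$ contains exactly one $(T,T')$-path. Then $S''=\{s'_3,s'_4\}$.
   Context: $\mathrm{XCH}$ is the plane graph drawn with straight edges on the vertices (with coordinates) $t_1(4,22)$, $t_2(4,10)$, $t'_1(24,22)$, $t'_2(24,10)$, $s_1(6,24)$, $s_2(10,24)$, $s_3(18,24)$, $s_4(22,24)$, $s'_1(6,8)$, $s'_2(10,8)$, $s'_3(18,8)$, $s'_4(22,8)$, $u_1(6,22)$, $u_2(10,22)$, $u_3(18,22)$, $u_4(22,22)$, $u_5(10,18)$, $u_6(18,18)$, $u_7(10,14)$, $u_8(18,14)$, $u_9(6,10)$, $u_{10}(10,10)$, $u_{11}(18,10)$, $u_{12}(22,10)$, $a(14,18)$, $b(12,16)$, $c(16,16)$, $d(14,14)$, with edges $s_1u_1, t_1u_1, u_1u_2, u_1u_5, s_2u_2, u_2u_5, u_2a, s_3u_3, u_3u_4, u_3u_6, u_3a, s_4u_4, t'_1u_4, u_4u_6, u_5u_7, u_5b, u_6u_8, u_6c, u_7u_9, u_7u_{10}, u_7b, u_8u_{11}, u_8u_{12}, u_8c, t_2u_9, s'_1u_9, u_9u_{10}, s'_2u_{10}, u_{10}d, s'_3u_{11}, u_{11}u_{12}, u_{11}d, t'_2u_{12}, s'_4u_{12},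 ab, ac, bd, cd$. Let $T=\{t_1,t_2\}$, $T'=\{t'_1,t'_2\}$; an $(X,Y)$-path is a path with one extremity in $X$ and the other in $Y$. A path is a sequence of distinct consecutive edges. Two edge-disjoint paths $P_1,P_2$ cross at a vertex $v$ if there are four edges $e_1,\dots,e_4$ incident to $v$, in this cyclic order around $v$ in the drawing, with $e_1,e_3$ consecutive in $P_1$ and $e_2,e_4$ consecutive in $P_2$. In $\mathrm{XCH}$ only $a,b,c,d$ are crossing vertices: paths are not allowed to cross at any other vertex. -}

module Defs where

open import Data.Bool using (Bool; true; false; _∨_; _∧_)
open import Data.Nat using (ℕ)
open import Data.Fin using (Fin)
open import Data.Integer using (ℤ; +_; _-_; _*_; _<_)
open import Data.List using (List; []; _∷_; _++_)
open import Data.List.Membership.Propositional using (_∈_)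
open import Data.List.Relation.Unary.Unique.Propositional using (Unique)
open import Data.Product using (_×_; _,_; Σ; ∃-syntax)
open import Data.Sum using (_⊎_)
open import Data.Empty using (⊥)
open import Relation.Nullary using (¬_)
open import Relation.Binary.PropositionalEquality using (_≡_; _≢_)

data V : Set where
  t1 t2 t1' t2' : V
  s1 s2 s3 s4 s1' s2' s3' s4' : V
  u1 u2 u3 u4 u5 u6 u7 u8 u9 u10 u11 u12 : V
  a b c d : V

-- coordinates of the straight-line drawing
pos : V → ℤ × ℤ
pos t1  = + 4  , + 22
pos t2  = + 4  , + 10
pos t1' = + 24 , + 22
pos t2' = + 24 , + 10
pos s1  = + 6  , + 24
pos s2  = + 10 , + 24
pos s3  = + 18 , + 24
pos s4  = + 22 , + 24
pos s1' = + 6  , + 8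
pos s2' = + 10 , + 8
pos s3' = + 18 , + 8
pos s4' = + 22 , + 8
pos u1  = + 6  , + 22
pos u2  = + 10 , + 22
pos u3  = + 18 , + 22
pos u4  = + 22 , + 22
pos u5  = + 10 , + 18
pos u6  = + 18 , + 18
pos u7  = + 10 , + 14
pos u8  = + 18 , + 14
pos u9  = + 6  , + 10
pos u10 = + 10 , + 10
pos u11 = + 18 , + 10
pos u12 = + 22 , + 10
pos a   = + 14 , + 18
pos b   = + 12 , + 16
pos c   = + 16 , + 16
pos d   = + 14 , + 14

data E : Set where
  s1-u1 t1-u1 u1-u2 u1-u5 s2-u2 u2-u5 u2-a : E
  s3-u3 u3-u4 u3-u6 u3-a s4-u4 t1'-u4 u4-u6 : E
  u5-u7 u5-b u6-u8 u6-c u7-u9 u7-u10 u7-b : E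
  u8-u11 u8-u12 u8-c t2-u9 s1'-u9 u9-u10 s2'-u10 u10-d : E
  s3'-u11 u11-u12 u11-d t2'-u12 s4'-u12 a-b a-c b-d c-d : E

ends : E → V × V
ends s1-u1   = s1 , u1
ends t1-u1   = t1 , u1
ends u1-u2   = u1 , u2
ends u1-u5   = u1 , u5
ends s2-u2   = s2 , u2
ends u2-u5   = u2 , u5
ends u2-a    = u2 , a
ends s3-u3   = s3 , u3
ends u3-u4   = u3 , u4
ends u3-u6   = u3 , u6
ends u3-a    = u3 , a
ends s4-u4   = s4 , u4
ends t1'-u4  = t1' , u4
ends u4-u6   = u4 , u6
ends u5-u7   = u5 , u7
ends u5-b    = u5 , b
ends u6-u8   = u6 , u8
ends u6-c    = u6 , c
ends u7-u9   = u7 , u9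
ends u7-u10  = u7 , u10
ends u7-b    = u7 , b
ends u8-u11  = u8 , u11
ends u8-u12  = u8 , u12
ends u8-c    = u8 , c
ends t2-u9   = t2 , u9
ends s1'-u9  = s1' , u9
ends u9-u10  = u9 , u10
ends s2'-u10 = s2' , u10
ends u10-d   = u10 , d
ends s3'-u11 = s3' , u11
ends u11-u12 = u11 , u12
ends u11-d   = u11 , d
ends t2'-u12 = t2' , u12
ends s4'-u12 = s4' , u12
ends a-b     = a , b
ends a-c     = a , c
ends b-d     = b , d
ends c-d     = c , d

Joins : E → V → V → Set
Joins e v w = (ends e ≡ (v , w)) ⊎ (ends e ≡ (w , v))

data Walk : V → V → List E → Set where
  nil  : ∀ {v} → Walk v v []
  cons : ∀ {u w x es} (e : E) → Joins e u w → Walk w x es → Walk u x (e ∷ es)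

record Path : Set where
  field
    start  : V
    end    : V
    edges  : List E
    walk   : Walk start end edges
    nonempty : edges ≢ []
    distinct : Unique edges
open Path public

Consecutive : Path → E → E → Set
Consecutive P e f = ∃[ xs ] ∃[ ys ] (edges P ≡ xs ++ e ∷ f ∷ ys)

EdgeDisjoint : Path → Path → Set
EdgeDisjoint P Q = ∀ e → e ∈ edges P → e ∈ edges Q → ⊥

-- Cyclic order of edges around a vertex, computed from the drawing

Vec2 : Set
Vec2 = ℤ × ℤ

diff : Vec2 → Vec2 → Vec2
diff (x₁ , y₁) (x₂ , y₂) = (x₁ - x₂) , (y₁ - y₂)

cross : Vec2 → Vec2 → ℤ
cross (x₁ , y₁) (x₂ , y₂) = x₁ * y₂ - y₁ * x₂

-- direction has angle in [0, π)
Upper : Vec2 → Set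
Upper (x , y) = (+ 0 < y) ⊎ ((y ≡ + 0) × (+ 0 < x))

-- angle of u (in [0,2π)) is strictly smaller than angle of w
AngLt : Vec2 → Vec2 → Set
AngLt u w = (Upper u × ¬ Upper w)
          ⊎ (((Upper u × Upper w) ⊎ (¬ Upper u × ¬ Upper w)) × (+ 0 < cross u w))

Increasing4 : Vec2 → Vec2 → Vec2 → Vec2 → Set
Increasing4 p q r s = AngLt p q × AngLt q r × AngLt r s

CcwCyclic : Vec2 → Vec2 → Vec2 → Vec2 → Set
CcwCyclic p q r s = Increasing4 p q r s ⊎ Increasing4 q r s p
                  ⊎ Increasing4 r s p q ⊎ Increasing4 s p q r

CyclicOrder : Vec2 → Vec2 → Vec2 → Vec2 → Set
CyclicOrder p q r s = CcwCyclic p q r s ⊎ CcwCyclic s r q p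

dirTo : V → V → Vec2
dirTo v w = diff (pos w) (pos v)

CrossAt : Path → Path → V → Set
CrossAt P Q v =
  Σ E λ e₁ → Σ E λ e₂ → Σ E λ e₃ → Σ E λ e₄ →
  Σ V λ w₁ → Σ V λ w₂ → Σ V λ w₃ → Σ V λ w₄ →
    Joins e₁ v w₁ × Joins e₂ v w₂ × Joins e₃ v w₃ × Joins e₄ v w₄ ×
    CyclicOrder (dirTo v w₁) (dirTo v w₂) (dirTo v w₃) (dirTo v w₄) ×
    Consecutive P e₁ e₃ × Consecutive Q e₂ e₄

CrossingVertex : V → Set
CrossingVertex v = (v ≡ a) ⊎ (v ≡ b) ⊎ (v ≡ c) ⊎ (v ≡ d)

Subset : Set
Subset = V → Bool

T : Subset
T t1 = true
T t2 = true
T _  = false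

T' : Subset
T' t1' = true
T' t2' = true
T' _   = false

S12 : Subset
S12 s1 = true
S12 s2 = true
S12 _  = false

data Side : Set where
  left right : Side

S'' : Side → Subset
S'' left s1' = true
S'' left s2' = true
S'' right s3' = true
S'' right s4' = true
S'' _ _ = false

isXYPath : Subset → Subset → Path → Bool
isXYPath X Y P = (X (start P) ∧ Y (end P)) ∨ (Y (start P) ∧ X (end P))

b2n : Bool → ℕ
b2n true = 1
b2n false = 0

open import Data.Nat using (_+_)
open import Data.Fin using (zero; suc)

countXY : Subset → Subset → (Fin 3 → Path) → ℕ
countXY X Y P = b2n (isXYPath X Y (P zero)) + b2n (isXYPath X Y (P (suc zero)))
              + b2n (isXYPath X Y (P (suc (suc zero))))

module Submission where

-- Suppose S'' = {s'₁, s'₂}, let Q be the (T,T')-path and X, Y the two (S₁₂,S'')-paths.  If Q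
-- starts at t₁, then X and Y start at s₁ and s₂, whose only edges are s₁u₁ and s₂u₂.  Two paths
-- meeting at a vertex of degree four along neighbouring edges must leave it along the other two
-- edges without interleaving, so at u₁, u₂ and u₅ the drawing forces X along s₁u₁u₂u₅ and Q along
-- t₁u₁u₅u₇.  The region {t₂, s'₁, s'₂, u₇, u₉, u₁₀} is cut off by the three edges u₅u₇, u₇b, u₁₀d:
-- Q enters it along u₅u₇ and has to leave it again, while X and Y have to enter it, and three
-- pairwise edge-disjoint paths cannot do this.  If Q starts at t₂ the same happens upside down,
-- with X, Y ending at s'₁, s'₂ and the region {t₁, s₁, s₂, u₁, u₂, u₅}.

open import Defs
open import Data.Bool using (Bool; true; false; _∧_; _∨_; _xor_)
import Data.Bool.Properties as Bool
open import Data.Empty using (⊥; ⊥-elim)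
open import Data.Fin using (Fin; zero; suc; #_)
import Data.Fin.Properties as Fin
import Data.Integer as ℤ
open import Data.List using (List; []; _∷_; _++_; foldr; lookup)
open import Data.List.Membership.Propositional using (_∈_)
open import Data.List.Membership.Propositional.Properties using (∈-lookup; ∈-++⁺ʳ)
open import Data.List.Relation.Unary.All as All using (all?; _∷_)
open import Data.List.Relation.Unary.AllPairs using (_∷_)
open import Data.List.Relation.Unary.Any using (here; there; index)
open import Data.List.Relation.Unary.Any.Properties using (lookup-index)
open import Data.List.Relation.Unary.Unique.Propositional using (Unique)
open import Data.Nat using (ℕ; _+_)
open import Data.Product using (∃-syntax; _×_; _,_; proj₁; proj₂)
open import Data.Sum using (_⊎_; inj₁; inj₂)
open import Function using (_∘_; case_of_)
open import Level using (0ℓ)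
open import Relation.Binary.Definitions using (DecidableEquality)
open import Relation.Binary.PropositionalEquality
  using (_≡_; _≢_; refl; sym; trans; cong; cong₂; module ≡-Reasoning)
open import Relation.Nullary using (¬_; Dec)
open import Relation.Nullary.Decidable
  using (True; False; toWitness; toWitnessFalse; map′; ¬?; _×-dec_; _⊎-dec_; _→-dec_)
open import Relation.Unary using (Pred; Decidable)

module Enumeration {A : Set} {xs : List A} (complete : ∀ x → x ∈ xs) where

  infix 4 _≟_
  _≟_ : DecidableEquality A
  x ≟ y = map′ index-injective (cong (index ∘ complete))
               (index (complete x) Fin.≟ index (complete y))
    where
    index-injective : index (complete x) ≡ index (complete y) → x ≡ y
    index-injective eq = begin
      x                              ≡⟨ lookup-index (complete x) ⟩
      lookup xs (index (complete x)) ≡⟨ cong (lookup xs) eq ⟩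
      lookup xs (index (complete y)) ≡⟨ lookup-index (complete y) ⟨
      y                              ∎
      where open ≡-Reasoning

  decide-∀ : {P : Pred A 0ℓ} (P? : Decidable P) → {True (all? P? xs)} → ∀ x → P x
  decide-∀ P? {holds} x = All.lookup (toWitness holds) (complete x)

  decide-∀₂ : {R : A → A → Set} (R? : ∀ x y → Dec (R x y)) →
              {True (all? (λ x → all? (R? x) xs) xs)} → ∀ x y → R x y
  decide-∀₂ R? {holds} x y = All.lookup (decide-∀ (λ x → all? (R? x) xs) {holds} x) (complete y)

allV : List V
allV = t1 ∷ t2 ∷ t1' ∷ t2' ∷ s1 ∷ s2 ∷ s3 ∷ s4 ∷ s1' ∷ s2' ∷ s3' ∷ s4' ∷
       u1 ∷ u2 ∷ u3 ∷ u4 ∷ u5 ∷ u6 ∷ u7 ∷ u8 ∷ u9 ∷ u10 ∷ u11 ∷ u12 ∷ a ∷ b ∷ c ∷ d ∷ []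

∈-allV : ∀ v → v ∈ allV
∈-allV t1  = ∈-lookup (# 0)
∈-allV t2  = ∈-lookup (# 1)
∈-allV t1' = ∈-lookup (# 2)
∈-allV t2' = ∈-lookup (# 3)
∈-allV s1  = ∈-lookup (# 4)
∈-allV s2  = ∈-lookup (# 5)
∈-allV s3  = ∈-lookup (# 6)
∈-allV s4  = ∈-lookup (# 7)
∈-allV s1' = ∈-lookup (# 8)
∈-allV s2' = ∈-lookup (# 9)
∈-allV s3' = ∈-lookup (# 10)
∈-allV s4' = ∈-lookup (# 11)
∈-allV u1  = ∈-lookup (# 12)
∈-allV u2  = ∈-lookup (# 13)
∈-allV u3  = ∈-lookup (# 14)
∈-allV u4  = ∈-lookup (# 15)
∈-allV u5  = ∈-lookup (# 16)
∈-allV u6  = ∈-lookup (# 17)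
∈-allV u7  = ∈-lookup (# 18)
∈-allV u8  = ∈-lookup (# 19)
∈-allV u9  = ∈-lookup (# 20)
∈-allV u10 = ∈-lookup (# 21)
∈-allV u11 = ∈-lookup (# 22)
∈-allV u12 = ∈-lookup (# 23)
∈-allV a   = ∈-lookup (# 24)
∈-allV b   = ∈-lookup (# 25)
∈-allV c   = ∈-lookup (# 26)
∈-allV d   = ∈-lookup (# 27)

allE : List E
allE = s1-u1 ∷ t1-u1 ∷ u1-u2 ∷ u1-u5 ∷ s2-u2 ∷ u2-u5 ∷ u2-a ∷
       s3-u3 ∷ u3-u4 ∷ u3-u6 ∷ u3-a ∷ s4-u4 ∷ t1'-u4 ∷ u4-u6 ∷
       u5-u7 ∷ u5-b ∷ u6-u8 ∷ u6-c ∷ u7-u9 ∷ u7-u10 ∷ u7-b ∷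
       u8-u11 ∷ u8-u12 ∷ u8-c ∷ t2-u9 ∷ s1'-u9 ∷ u9-u10 ∷ s2'-u10 ∷ u10-d ∷
       s3'-u11 ∷ u11-u12 ∷ u11-d ∷ t2'-u12 ∷ s4'-u12 ∷ a-b ∷ a-c ∷ b-d ∷ c-d ∷ []

∈-allE : ∀ e → e ∈ allE
∈-allE s1-u1   = ∈-lookup (# 0)
∈-allE t1-u1   = ∈-lookup (# 1)
∈-allE u1-u2   = ∈-lookup (# 2)
∈-allE u1-u5   = ∈-lookup (# 3)
∈-allE s2-u2   = ∈-lookup (# 4)
∈-allE u2-u5   = ∈-lookup (# 5)
∈-allE u2-a    = ∈-lookup (# 6)
∈-allE s3-u3   = ∈-lookup (# 7)
∈-allE u3-u4   = ∈-lookup (# 8)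
∈-allE u3-u6   = ∈-lookup (# 9)
∈-allE u3-a    = ∈-lookup (# 10)
∈-allE s4-u4   = ∈-lookup (# 11)
∈-allE t1'-u4  = ∈-lookup (# 12)
∈-allE u4-u6   = ∈-lookup (# 13)
∈-allE u5-u7   = ∈-lookup (# 14)
∈-allE u5-b    = ∈-lookup (# 15)
∈-allE u6-u8   = ∈-lookup (# 16)
∈-allE u6-c    = ∈-lookup (# 17)
∈-allE u7-u9   = ∈-lookup (# 18)
∈-allE u7-u10  = ∈-lookup (# 19)
∈-allE u7-b    = ∈-lookup (# 20)
∈-allE u8-u11  = ∈-lookup (# 21)
∈-allE u8-u12  = ∈-lookup (# 22)
∈-allE u8-c    = ∈-lookup (# 23)
∈-allE t2-u9   = ∈-lookup (# 24)
∈-allE s1'-u9  = ∈-lookup (# 25)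
∈-allE u9-u10  = ∈-lookup (# 26)
∈-allE s2'-u10 = ∈-lookup (# 27)
∈-allE u10-d   = ∈-lookup (# 28)
∈-allE s3'-u11 = ∈-lookup (# 29)
∈-allE u11-u12 = ∈-lookup (# 30)
∈-allE u11-d   = ∈-lookup (# 31)
∈-allE t2'-u12 = ∈-lookup (# 32)
∈-allE s4'-u12 = ∈-lookup (# 33)
∈-allE a-b     = ∈-lookup (# 34)
∈-allE a-c     = ∈-lookup (# 35)
∈-allE b-d     = ∈-lookup (# 36)
∈-allE c-d     = ∈-lookup (# 37)

module Vertex = Enumeration ∈-allV
module Edge = Enumeration ∈-allE

open import Data.List.Membership.DecPropositional Edge._≟_ using (_∈?_)

cyclicOrder? : (p q r s : Vec2) → Dec (CyclicOrder p q r s)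
cyclicOrder? p q r s = ccw? p q r s ⊎-dec ccw? s r q p
  where
  upper? : (u : Vec2) → Dec (Upper u)
  upper? (x , y) = (ℤ.+ 0 ℤ.<? y) ⊎-dec ((y ℤ.≟ ℤ.+ 0) ×-dec (ℤ.+ 0 ℤ.<? x))

  angLt? : (u w : Vec2) → Dec (AngLt u w)
  angLt? u w = (upper? u ×-dec ¬? (upper? w))
    ⊎-dec (((upper? u ×-dec upper? w) ⊎-dec (¬? (upper? u) ×-dec ¬? (upper? w)))
           ×-dec (ℤ.+ 0 ℤ.<? cross u w))

  increasing? : (p q r s : Vec2) → Dec (Increasing4 p q r s)
  increasing? p q r s = angLt? p q ×-dec angLt? q r ×-dec angLt? r s

  ccw? : (p q r s : Vec2) → Dec (CcwCyclic p q r s)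
  ccw? p q r s = increasing? p q r s ⊎-dec increasing? q r s p
           ⊎-dec increasing? r s p q ⊎-dec increasing? s p q r

ccw-rotate : ∀ {p q r s} → CcwCyclic p q r s → CcwCyclic q r s p
ccw-rotate (inj₁ i)               = inj₂ (inj₂ (inj₂ i))
ccw-rotate (inj₂ (inj₁ i))        = inj₁ i
ccw-rotate (inj₂ (inj₂ (inj₁ i))) = inj₂ (inj₁ i)
ccw-rotate (inj₂ (inj₂ (inj₂ i))) = inj₂ (inj₂ (inj₁ i))

cyclicOrder-swap₁₃ : ∀ {p q r s} → CyclicOrder p q r s → CyclicOrder r q p s
cyclicOrder-swap₁₃ (inj₁ o) = inj₂ (ccw-rotate (ccw-rotate (ccw-rotate o)))
cyclicOrder-swap₁₃ (inj₂ o) = inj₁ (ccw-rotate o)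

cyclicOrder-swap₂₄ : ∀ {p q r s} → CyclicOrder p q r s → CyclicOrder p s r q
cyclicOrder-swap₂₄ (inj₁ o) = inj₂ (ccw-rotate o)
cyclicOrder-swap₂₄ (inj₂ o) = inj₁ (ccw-rotate (ccw-rotate (ccw-rotate o)))

joins-sym : ∀ {e x y} → Joins e x y → Joins e y x
joins-sym (inj₁ p) = inj₂ p
joins-sym (inj₂ p) = inj₁ p

joins-endpoint : ∀ {e x y v w} → Joins e x y → Joins e v w → v ≡ x ⊎ v ≡ y
joins-endpoint (inj₁ p) (inj₁ q) = inj₁ (cong proj₁ (trans (sym q) p))
joins-endpoint (inj₁ p) (inj₂ q) = inj₂ (cong proj₂ (trans (sym q) p))
joins-endpoint (inj₂ p) (inj₁ q) = inj₂ (cong proj₁ (trans (sym q) p))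
joins-endpoint (inj₂ p) (inj₂ q) = inj₁ (cong proj₂ (trans (sym q) p))

ConsecutiveIn : List E → E → E → Set
ConsecutiveIn es e f = ∃[ xs ] ∃[ ys ] (es ≡ xs ++ e ∷ f ∷ ys)

AdjacentIn : List E → E → E → Set
AdjacentIn es e f = ConsecutiveIn es e f ⊎ ConsecutiveIn es f e

adjacentIn-∈ : ∀ {es e f} → AdjacentIn es e f → f ∈ es
adjacentIn-∈ (inj₁ (xs , _ , refl)) = ∈-++⁺ʳ xs (there (here refl))
adjacentIn-∈ (inj₂ (xs , _ , refl)) = ∈-++⁺ʳ xs (here refl)

unique-no-repeat : ∀ {e : E} {ys} xs → ¬ Unique (xs ++ e ∷ e ∷ ys)
unique-no-repeat []       ((e≢e ∷ _) ∷ _) = e≢e refl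
unique-no-repeat (_ ∷ xs) (_ ∷ unique)    = unique-no-repeat xs unique

adjacentIn-irrefl : ∀ {es e} → Unique es → ¬ AdjacentIn es e e
adjacentIn-irrefl unique (inj₁ (xs , _ , refl)) = unique-no-repeat xs unique
adjacentIn-irrefl unique (inj₂ (xs , _ , refl)) = unique-no-repeat xs unique

record NeighbourAt (v : V) (es : List E) (e : E) : Set where
  constructor neighbour
  field
    {edge}   : E
    {far}    : V
    joins    : Joins edge v far
    adjacent : AdjacentIn es e edge

edge-at : ∀ {x y es e v w} → Walk x y es → e ∈ es → Joins e v w → v ≢ y →
          (v ≡ x × ∃[ es′ ] es ≡ e ∷ es′) ⊎ NeighbourAt v es e
edge-at (cons e j rest) (here refl) jv v≢y with joins-endpoint j jv
... | inj₁ v≡x = inj₁ (v≡x , _ , refl)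
... | inj₂ refl with rest
...   | nil        = ⊥-elim (v≢y refl)
...   | cons f j′ _ = inj₂ (neighbour j′ (inj₁ ([] , _ , refl)))
edge-at (cons e₀ j rest) (there e∈) jv v≢y with edge-at rest e∈ jv v≢y
... | inj₁ (refl , es′ , refl) = inj₂ (neighbour (joins-sym j) (inj₂ ([] , es′ , refl)))
... | inj₂ (neighbour jf (inj₁ (xs , ys , eq))) =
  inj₂ (neighbour jf (inj₁ (e₀ ∷ xs , ys , cong (e₀ ∷_) eq)))
... | inj₂ (neighbour jf (inj₂ (xs , ys , eq))) =
  inj₂ (neighbour jf (inj₂ (e₀ ∷ xs , ys , cong (e₀ ∷_) eq)))

Internal : Path → V → Set
Internal P v = v ≢ start P × v ≢ end P

through : ∀ P {e v w} → e ∈ edges P → Joins e v w → Internal P v → NeighbourAt v (edges P) e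
through P e∈ jv (v≢start , v≢end) with edge-at (walk P) e∈ jv v≢end
... | inj₁ (v≡start , _) = ⊥-elim (v≢start v≡start)
... | inj₂ n             = n

data Ends (P : Path) : V → V → Set where
  forwards  : Ends P (start P) (end P)
  backwards : Ends P (end P) (start P)

ends-sym : ∀ {P x y} → Ends P x y → Ends P y x
ends-sym forwards  = backwards
ends-sym backwards = forwards

internal : ∀ {P x y v} → Ends P x y → v ≢ x → v ≢ y → Internal P v
internal forwards  v≢x v≢y = v≢x , v≢y
internal backwards v≢x v≢y = v≢y , v≢x

first-edge : ∀ {x y es} → Walk x y es → es ≢ [] → ∃[ e ] ∃[ w ] e ∈ es × Joins e x w
first-edge nil          es≢[] = ⊥-elim (es≢[] refl)
first-edge (cons e j _) _     = e , _ , here refl , j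

last-edge : ∀ {x y es} → Walk x y es → es ≢ [] → ∃[ e ] ∃[ w ] e ∈ es × Joins e y w
last-edge nil                   es≢[] = ⊥-elim (es≢[] refl)
last-edge (cons e j nil)        _     = e , _ , here refl , joins-sym j
last-edge (cons _ _ rest@(cons _ _ _)) _ with last-edge rest (λ ())
... | e , w , e∈ , je = e , w , there e∈ , je

end-edge : ∀ {P x y} → Ends P x y → ∃[ e ] ∃[ w ] e ∈ edges P × Joins e x w
end-edge {P} forwards  = first-edge (walk P) (nonempty P)
end-edge {P} backwards = last-edge (walk P) (nonempty P)

EdgesAt : V → List E → Set
EdgesAt v es = ∀ {f w} → Joins f v w → f ∈ es

pendant-∈ : ∀ {P x y e} → Ends P x y → EdgesAt x (e ∷ []) → e ∈ edges P
pendant-∈ ends only with end-edge ends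
... | _ , _ , f∈ , jf with only jf
...   | here refl = f∈

∧-∨-∧-true : ∀ x y z w → (x ∧ y) ∨ (z ∧ w) ≡ true → (x ≡ true × y ≡ true) ⊎ (z ≡ true × w ≡ true)
∧-∨-∧-true true  true  _     _     _  = inj₁ (refl , refl)
∧-∨-∧-true true  false true  true  _  = inj₂ (refl , refl)
∧-∨-∧-true false _     true  true  _  = inj₂ (refl , refl)
∧-∨-∧-true true  false true  false ()
∧-∨-∧-true true  false false _     ()
∧-∨-∧-true false _     true  false ()
∧-∨-∧-true false _     false _     ()

xy-ends : ∀ {X Y R} → isXYPath X Y R ≡ true → ∃[ x ] ∃[ y ] X x ≡ true × Y y ≡ true × Ends R x y
xy-ends {X} {Y} {R} xy with ∧-∨-∧-true (X (start R)) (Y (end R)) (Y (start R)) (X (end R)) xy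
... | inj₁ (x∈ , y∈) = start R , end R , x∈ , y∈ , forwards
... | inj₂ (y∈ , x∈) = end R , start R , x∈ , y∈ , backwards

separated : ∀ (S : Subset) {v y} → S v ≡ false → S y ≡ true → v ≢ y
separated S v∉ y∈ refl with trans (sym y∈) v∉
... | ()

-- Paths meeting at a vertex of degree four

NonCrossing : Path → Path → Set
NonCrossing P Q = ∀ v → ¬ CrossingVertex v → ¬ CrossAt P Q v

record Compatible (P Q : Path) : Set where
  field
    disjoint   : EdgeDisjoint P Q
    uncrossed  : NonCrossing P Q
    uncrossed′ : NonCrossing Q P
open Compatible

compatible-sym : ∀ {P Q} → Compatible P Q → Compatible Q P
compatible-sym PQ = record
  { disjoint = λ e e∈Q e∈P → disjoint PQ e e∈P e∈Q
  ; uncrossed = uncrossed′ PQ ; uncrossed′ = uncrossed PQ }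

record CyclicStar (v : V) (e₁ e₂ e₃ e₄ : E) : Set where
  field
    {w₁ w₂ w₃ w₄} : V
    joins₁   : Joins e₁ v w₁
    joins₂   : Joins e₂ v w₂
    joins₃   : Joins e₃ v w₃
    joins₄   : Joins e₄ v w₄
    cyclic   : CyclicOrder (dirTo v w₁) (dirTo v w₂) (dirTo v w₃) (dirTo v w₄)
    complete : EdgesAt v (e₁ ∷ e₂ ∷ e₃ ∷ e₄ ∷ [])

module _ {v e₁ e₂ e₃ e₄} (star : CyclicStar v e₁ e₂ e₃ e₄) where
  open CyclicStar star

  interleaved⇒crossing : ∀ {P Q} → AdjacentIn (edges P) e₁ e₃ → AdjacentIn (edges Q) e₂ e₄ →
                         CrossAt P Q v
  interleaved⇒crossing (inj₁ p) (inj₁ q) =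
    e₁ , e₂ , e₃ , e₄ , w₁ , w₂ , w₃ , w₄ , joins₁ , joins₂ , joins₃ , joins₄ , cyclic , p , q
  interleaved⇒crossing (inj₂ p) (inj₁ q) =
    e₃ , e₂ , e₁ , e₄ , w₃ , w₂ , w₁ , w₄ , joins₃ , joins₂ , joins₁ , joins₄ ,
    cyclicOrder-swap₁₃ cyclic , p , q
  interleaved⇒crossing (inj₁ p) (inj₂ q) =
    e₁ , e₄ , e₃ , e₂ , w₁ , w₄ , w₃ , w₂ , joins₁ , joins₄ , joins₃ , joins₂ ,
    cyclicOrder-swap₂₄ cyclic , p , q
  interleaved⇒crossing (inj₂ p) (inj₂ q) =
    e₃ , e₄ , e₁ , e₂ , w₃ , w₄ , w₁ , w₂ , joins₃ , joins₄ , joins₁ , joins₂ ,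
    cyclicOrder-swap₂₄ (cyclicOrder-swap₁₃ cyclic) , p , q

  remaining : ∀ {f} → f ∈ e₁ ∷ e₂ ∷ e₃ ∷ e₄ ∷ [] → f ≢ e₁ → f ≢ e₂ → f ≡ e₃ ⊎ f ≡ e₄
  remaining (here refl)                         f≢e₁ _    = ⊥-elim (f≢e₁ refl)
  remaining (there (here refl))                 _    f≢e₂ = ⊥-elim (f≢e₂ refl)
  remaining (there (there (here refl)))         _    _    = inj₁ refl
  remaining (there (there (there (here refl)))) _    _    = inj₂ refl

  -- P and Q each leave v along e₃ or e₄, on different edges; P leaving along e₃ would make
  -- the pairs {e₁, e₃} and {e₂, e₄} interleave around v.
  uncrossed-exits : ∀ {P Q} → Compatible P Q → ¬ CrossingVertex v → Internal P v → Internal Q v →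
                    e₁ ∈ edges P → e₂ ∈ edges Q → e₄ ∈ edges P × e₃ ∈ edges Q
  uncrossed-exits {P} {Q} PQ v-ordinary P° Q° e₁∈P e₂∈Q
    with through P e₁∈P joins₁ P° | through Q e₂∈Q joins₂ Q°
  ... | neighbour jf adjP | neighbour jg adjQ
    with remaining (complete jf) (λ { refl → adjacentIn-irrefl (distinct P) adjP })
                                 (λ { refl → disjoint PQ _ (adjacentIn-∈ adjP) e₂∈Q })
       | remaining (complete jg) (λ { refl → disjoint PQ _ e₁∈P (adjacentIn-∈ adjQ) })
                                 (λ { refl → adjacentIn-irrefl (distinct Q) adjQ })
  ... | inj₁ refl | inj₁ refl = ⊥-elim (disjoint PQ _ (adjacentIn-∈ adjP) (adjacentIn-∈ adjQ))
  ... | inj₂ refl | inj₂ refl = ⊥-elim (disjoint PQ _ (adjacentIn-∈ adjP) (adjacentIn-∈ adjQ))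
  ... | inj₁ refl | inj₂ refl =
    ⊥-elim (uncrossed PQ v v-ordinary (interleaved⇒crossing {P} {Q} adjP adjQ))
  ... | inj₂ refl | inj₁ refl = adjacentIn-∈ adjP , adjacentIn-∈ adjQ

-- Parity across a cut

crosses : Subset → E → Bool
crosses S e = S (proj₁ (ends e)) xor S (proj₂ (ends e))

parity : Subset → List E → Bool
parity S = foldr (λ e p → crosses S e xor p) false

crosses-joins : ∀ S {e v w} → Joins e v w → crosses S e ≡ S v xor S w
crosses-joins S (inj₁ p) rewrite p = refl
crosses-joins S {v = v} {w} (inj₂ p) rewrite p = Bool.xor-comm (S w) (S v)

xor-cancel-middle : ∀ x y z → (x xor y) xor (y xor z) ≡ x xor z
xor-cancel-middle x y z = begin
  (x xor y) xor (y xor z) ≡⟨ Bool.xor-assoc x y (y xor z) ⟩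
  x xor (y xor (y xor z)) ≡⟨ cong (x xor_) (Bool.xor-assoc y y z) ⟨
  x xor ((y xor y) xor z) ≡⟨ cong (λ y⊕y → x xor (y⊕y xor z)) (Bool.xor-same y) ⟩
  x xor z                 ∎
  where open ≡-Reasoning

parity-walk : ∀ S {x y es} → Walk x y es → parity S es ≡ S x xor S y
parity-walk S {x} nil = sym (Bool.xor-same (S x))
parity-walk S {x} {y} (cons {w = w} {es = es} e j rest) = begin
  crosses S e xor parity S es     ≡⟨ cong₂ _xor_ (crosses-joins S j) (parity-walk S rest) ⟩
  (S x xor S w) xor (S w xor S y) ≡⟨ xor-cancel-middle (S x) (S w) (S y) ⟩
  S x xor S y                     ∎
  where open ≡-Reasoning

parity-ends : ∀ S {P x y} → Ends P x y → parity S (edges P) ≡ S x xor S y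
parity-ends S {P} forwards  = parity-walk S (walk P)
parity-ends S {P} backwards =
  trans (parity-walk S (walk P)) (Bool.xor-comm (S (start P)) (S (end P)))

odd⇒crossing : ∀ S es → parity S es ≡ true → ∃[ e ] e ∈ es × crosses S e ≡ true
odd⇒crossing S (f ∷ es) odd with crosses S f in cf
... | true  = f , here refl , cf
... | false with odd⇒crossing S es odd
...   | e , e∈ , ce = e , there e∈ , ce

even⇒second-crossing : ∀ S {e} es → Unique es → e ∈ es → crosses S e ≡ true →
                       parity S es ≡ false → ∃[ e′ ] e′ ∈ es × e′ ≢ e × crosses S e′ ≡ true
even⇒second-crossing S (f ∷ es) (f∉es ∷ _) (here refl) cf even rewrite cf
  with odd⇒crossing S es (Bool.not-injective {y = true} even)
... | e′ , e′∈ , ce′ = e′ , there e′∈ , (λ e′≡f → All.lookup f∉es e′∈ (sym e′≡f)) , ce′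
even⇒second-crossing S (f ∷ es) (f∉es ∷ unique) (there e∈) ce even with crosses S f in cf
... | true  = f , here refl , All.lookup f∉es e∈ , cf
... | false with even⇒second-crossing S es unique e∈ ce even
...   | e′ , e′∈ , e′≢e , ce′ = e′ , there e′∈ , e′≢e , ce′

pigeonhole : ∀ {X Y Z : Path} {q r x y z} →
             EdgeDisjoint X Y → EdgeDisjoint X Z → EdgeDisjoint Y Z →
             x ∈ edges X → y ∈ edges Y → z ∈ edges Z →
             x ≡ q ⊎ x ≡ r → y ≡ q ⊎ y ≡ r → z ≡ q ⊎ z ≡ r → ⊥
pigeonhole dXY _ _ x∈ y∈ _ (inj₁ refl) (inj₁ refl) _ = dXY _ x∈ y∈
pigeonhole dXY _ _ x∈ y∈ _ (inj₂ refl) (inj₂ refl) _ = dXY _ x∈ y∈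
pigeonhole _ dXZ _ x∈ _ z∈ (inj₁ refl) _ (inj₁ refl) = dXZ _ x∈ z∈
pigeonhole _ dXZ _ x∈ _ z∈ (inj₂ refl) _ (inj₂ refl) = dXZ _ x∈ z∈
pigeonhole _ _ dYZ _ y∈ z∈ _ (inj₁ refl) (inj₁ refl) = dYZ _ y∈ z∈
pigeonhole _ _ dYZ _ y∈ z∈ _ (inj₂ refl) (inj₂ refl) = dYZ _ y∈ z∈

module _ (S : Subset) {p q r : E} (cut : ∀ e → crosses S e ≡ true → e ∈ p ∷ q ∷ r ∷ []) where

  crossing-besides : ∀ {e} → crosses S e ≡ true → e ≢ p → e ≡ q ⊎ e ≡ r
  crossing-besides {e} ce e≢p with cut e ce
  ... | here refl                 = ⊥-elim (e≢p refl)
  ... | there (here refl)         = inj₁ refl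
  ... | there (there (here refl)) = inj₂ refl

  -- Z needs p and a second edge of the cut to get back, X and Y need one each,
  -- and only q and r remain.
  cut-overloaded : ∀ {X Y Z} → EdgeDisjoint X Y → EdgeDisjoint X Z → EdgeDisjoint Y Z →
                   parity S (edges X) ≡ true → parity S (edges Y) ≡ true →
                   parity S (edges Z) ≡ false → p ∈ edges Z → crosses S p ≡ true → ⊥
  cut-overloaded {X} {Y} {Z} dXY dXZ dYZ oddX oddY evenZ p∈Z cp
    with odd⇒crossing S (edges X) oddX | odd⇒crossing S (edges Y) oddY
       | even⇒second-crossing S (edges Z) (distinct Z) p∈Z cp evenZ
  ... | x , x∈X , cx | y , y∈Y , cy | z , z∈Z , z≢p , cz =
    pigeonhole {X} {Y} {Z} dXY dXZ dYZ x∈X y∈Y z∈Z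
      (crossing-besides cx (λ { refl → dXZ _ x∈X p∈Z }))
      (crossing-besides cy (λ { refl → dYZ _ y∈Y p∈Z }))
      (crossing-besides cz z≢p)

count : (Fin 3 → Bool) → ℕ
count p = b2n (p zero) + b2n (p (suc zero)) + b2n (p (suc (suc zero)))

record TwoAndOne (p q : Fin 3 → Bool) : Set where
  field
    i j k : Fin 3
    i≢j   : i ≢ j
    i≢k   : i ≢ k
    j≢k   : j ≢ k
    p-i   : p i ≡ true
    p-j   : p j ≡ true
    q-k   : q k ≡ true

two-and-one : ∀ p q → count p ≡ 2 → count q ≡ 1 → (∀ i → p i ≡ true → q i ≡ true → ⊥) →
              TwoAndOne p q
two-and-one p q two one exclusive
  with p zero in p₀ | p (suc zero) in p₁ | p (suc (suc zero)) in p₂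
     | q zero in q₀ | q (suc zero) in q₁ | q (suc (suc zero)) in q₂
... | true  | true  | false | false | false | true  = record
  { i = zero ; j = suc zero ; k = suc (suc zero)
  ; i≢j = λ () ; i≢k = λ () ; j≢k = λ () ; p-i = p₀ ; p-j = p₁ ; q-k = q₂ }
... | true  | false | true  | false | true  | false = record
  { i = zero ; j = suc (suc zero) ; k = suc zero
  ; i≢j = λ () ; i≢k = λ () ; j≢k = λ () ; p-i = p₀ ; p-j = p₂ ; q-k = q₁ }
... | false | true  | true  | true  | false | false = record
  { i = suc zero ; j = suc (suc zero) ; k = zero
  ; i≢j = λ () ; i≢k = λ () ; j≢k = λ () ; p-i = p₁ ; p-j = p₂ ; q-k = q₀ }
... | true  | _     | _     | true  | _     | _     = ⊥-elim (exclusive zero p₀ q₀)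
... | _     | true  | _     | _     | true  | _     = ⊥-elim (exclusive (suc zero) p₁ q₁)
... | _     | _     | true  | _     | _     | true  = ⊥-elim (exclusive (suc (suc zero)) p₂ q₂)
... | true  | true  | true  | _     | _     | _     = case two of λ ()
... | true  | false | false | _     | _     | _     = case two of λ ()
... | false | true  | false | _     | _     | _     = case two of λ ()
... | false | false | true  | _     | _     | _     = case two of λ ()
... | false | false | false | _     | _     | _     = case two of λ ()
... | true  | true  | false | false | false | false = case one of λ ()
... | true  | false | true  | false | false | false = case one of λ ()
... | false | true  | true  | false | false | false = case one of λ ()

Incident : V → E → Set
Incident v f = proj₁ (ends f) ≡ v ⊎ proj₂ (ends f) ≡ v

incident? : ∀ v f → Dec (Incident v f)
incident? v f = (proj₁ (ends f) Vertex.≟ v) ⊎-dec (proj₂ (ends f) Vertex.≟ v)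

joins⇒incident : ∀ {f v w} → Joins f v w → Incident v f
joins⇒incident (inj₁ p) = inj₁ (cong proj₁ p)
joins⇒incident (inj₂ p) = inj₂ (cong proj₂ p)

edgesAt : ∀ v es → {True (all? (λ f → incident? v f →-dec f ∈? es) allE)} → EdgesAt v es
edgesAt v es {holds} jf =
  Edge.decide-∀ (λ f → incident? v f →-dec f ∈? es) {holds} _ (joins⇒incident jf)

cyclicStar : ∀ {v e₁ e₂ e₃ e₄ w₁ w₂ w₃ w₄} →
             Joins e₁ v w₁ → Joins e₂ v w₂ → Joins e₃ v w₃ → Joins e₄ v w₄ →
             {True (cyclicOrder? (dirTo v w₁) (dirTo v w₂) (dirTo v w₃) (dirTo v w₄))} →
             {True (all? (λ f → incident? v f →-dec f ∈? e₁ ∷ e₂ ∷ e₃ ∷ e₄ ∷ []) allE)} →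
             CyclicStar v e₁ e₂ e₃ e₄
cyclicStar j₁ j₂ j₃ j₄ {cyclic} {complete} = record
  { joins₁ = j₁ ; joins₂ = j₂ ; joins₃ = j₃ ; joins₄ = j₄
  ; cyclic = toWitness cyclic ; complete = edgesAt _ _ {complete} }

star-u1 : CyclicStar u1 s1-u1 t1-u1 u1-u5 u1-u2
star-u1 = cyclicStar (inj₂ refl) (inj₂ refl) (inj₁ refl) (inj₁ refl)

star-u2 : CyclicStar u2 u1-u2 s2-u2 u2-a u2-u5
star-u2 = cyclicStar (inj₂ refl) (inj₂ refl) (inj₁ refl) (inj₁ refl)

star-u5 : CyclicStar u5 u2-u5 u1-u5 u5-u7 u5-b
star-u5 = cyclicStar (inj₂ refl) (inj₂ refl) (inj₁ refl) (inj₁ refl)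

star-u9 : CyclicStar u9 s1'-u9 t2-u9 u7-u9 u9-u10
star-u9 = cyclicStar (inj₂ refl) (inj₂ refl) (inj₂ refl) (inj₁ refl)

star-u10 : CyclicStar u10 u9-u10 s2'-u10 u10-d u7-u10
star-u10 = cyclicStar (inj₂ refl) (inj₂ refl) (inj₁ refl) (inj₂ refl)

star-u7 : CyclicStar u7 u7-u10 u7-u9 u5-u7 u7-b
star-u7 = cyclicStar (inj₁ refl) (inj₁ refl) (inj₂ refl) (inj₁ refl)

crossingVertex? : ∀ v → Dec (CrossingVertex v)
crossingVertex? v =
  (v Vertex.≟ a) ⊎-dec (v Vertex.≟ b) ⊎-dec (v Vertex.≟ c) ⊎-dec (v Vertex.≟ d)

ordinary : ∀ v → {False (crossingVertex? v)} → ¬ CrossingVertex v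
ordinary v {not-crossing} = toWitnessFalse not-crossing

upper-left : Subset
upper-left t1 = true
upper-left s1 = true
upper-left s2 = true
upper-left u1 = true
upper-left u2 = true
upper-left u5 = true
upper-left _  = false

lower-left : Subset
lower-left t2  = true
lower-left s1' = true
lower-left s2' = true
lower-left u9  = true
lower-left u10 = true
lower-left u7  = true
lower-left _   = false

upper-left-cut : ∀ e → crosses upper-left e ≡ true → e ∈ u5-u7 ∷ u2-a ∷ u5-b ∷ []
upper-left-cut = Edge.decide-∀ λ e →
  (crosses upper-left e Bool.≟ true) →-dec (e ∈? u5-u7 ∷ u2-a ∷ u5-b ∷ [])

lower-left-cut : ∀ e → crosses lower-left e ≡ true → e ∈ u5-u7 ∷ u7-b ∷ u10-d ∷ []
lower-left-cut = Edge.decide-∀ λ e →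
  (crosses lower-left e Bool.≟ true) →-dec (e ∈? u5-u7 ∷ u7-b ∷ u10-d ∷ [])

S12-cases : ∀ v → S12 v ≡ true → v ≡ s1 ⊎ v ≡ s2
S12-cases = Vertex.decide-∀ λ v →
  (S12 v Bool.≟ true) →-dec ((v Vertex.≟ s1) ⊎-dec (v Vertex.≟ s2))

S''-left-cases : ∀ v → S'' left v ≡ true → v ≡ s1' ⊎ v ≡ s2'
S''-left-cases = Vertex.decide-∀ λ v →
  (S'' left v Bool.≟ true) →-dec ((v Vertex.≟ s1') ⊎-dec (v Vertex.≟ s2'))

T-cases : ∀ v → T v ≡ true → v ≡ t1 ⊎ v ≡ t2
T-cases = Vertex.decide-∀ λ v →
  (T v Bool.≟ true) →-dec ((v Vertex.≟ t1) ⊎-dec (v Vertex.≟ t2))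

S12⊆upper-left : ∀ v → S12 v ≡ true → upper-left v ≡ true
S12⊆upper-left = Vertex.decide-∀ λ v → (S12 v Bool.≟ true) →-dec (upper-left v Bool.≟ true)

S''-left⊆lower-left : ∀ v → S'' left v ≡ true → lower-left v ≡ true
S''-left⊆lower-left = Vertex.decide-∀ λ v →
  (S'' left v Bool.≟ true) →-dec (lower-left v Bool.≟ true)

T'-outside-upper-left : ∀ v → T' v ≡ true → upper-left v ≡ false
T'-outside-upper-left = Vertex.decide-∀ λ v → (T' v Bool.≟ true) →-dec (upper-left v Bool.≟ false)

T'-outside-lower-left : ∀ v → T' v ≡ true → lower-left v ≡ false
T'-outside-lower-left = Vertex.decide-∀ λ v → (T' v Bool.≟ true) →-dec (lower-left v Bool.≟ false)

no-pair-is-both : ∀ x y →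
  ((S12 x ∧ S'' left y) ∨ (S'' left x ∧ S12 y)) ∧ ((T x ∧ T' y) ∨ (T' x ∧ T y)) ≡ false
no-pair-is-both = Vertex.decide-∀₂ λ _ _ → _ Bool.≟ false

-- The routings from t₁ and from t₂

blocked-t1-s1-s2 : ∀ {X Y Q y₁ y₂ z} → Compatible X Y → Compatible X Q → Compatible Y Q →
                   Ends X s1 y₁ → S'' left y₁ ≡ true → Ends Y s2 y₂ → S'' left y₂ ≡ true →
                   Ends Q t1 z → T' z ≡ true → ⊥
blocked-t1-s1-s2 {X} {Y} {Q} XY XQ YQ endsX y₁∈ endsY y₂∈ endsQ z∈ =
  cut-overloaded lower-left lower-left-cut {X} {Y} {Q} (disjoint XY) (disjoint XQ) (disjoint YQ)
    (trans (parity-ends lower-left endsX) (S''-left⊆lower-left _ y₁∈))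
    (trans (parity-ends lower-left endsY) (S''-left⊆lower-left _ y₂∈))
    (trans (parity-ends lower-left endsQ) (T'-outside-lower-left _ z∈))
    u5-u7∈Q refl
  where
  X° : ∀ {v} → v ≢ s1 → S'' left v ≡ false → Internal X v
  X° v≢s1 v∉ = internal endsX v≢s1 (separated (S'' left) v∉ y₁∈)

  Y° : ∀ {v} → v ≢ s2 → S'' left v ≡ false → Internal Y v
  Y° v≢s2 v∉ = internal endsY v≢s2 (separated (S'' left) v∉ y₂∈)

  Q° : ∀ {v} → v ≢ t1 → T' v ≡ false → Internal Q v
  Q° v≢t1 v∉ = internal endsQ v≢t1 (separated T' v∉ z∈)

  at-u1 : u1-u2 ∈ edges X × u1-u5 ∈ edges Q
  at-u1 = uncrossed-exits star-u1 XQ (ordinary u1)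
            (X° (λ ()) refl) (Q° (λ ()) refl)
            (pendant-∈ endsX (edgesAt _ _)) (pendant-∈ endsQ (edgesAt _ _))

  u2-u5∈X : u2-u5 ∈ edges X
  u2-u5∈X = proj₁ (uncrossed-exits star-u2 XY (ordinary u2)
              (X° (λ ()) refl) (Y° (λ ()) refl)
              (proj₁ at-u1) (pendant-∈ endsY (edgesAt _ _)))

  u5-u7∈Q : u5-u7 ∈ edges Q
  u5-u7∈Q = proj₂ (uncrossed-exits star-u5 XQ (ordinary u5)
              (X° (λ ()) refl) (Q° (λ ()) refl)
              u2-u5∈X (proj₂ at-u1))

blocked-t2-s1'-s2' : ∀ {X Y Q x₁ x₂ z} → Compatible X Y → Compatible X Q → Compatible Y Q →
                     Ends X s1' x₁ → S12 x₁ ≡ true → Ends Y s2' x₂ → S12 x₂ ≡ true →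
                     Ends Q t2 z → T' z ≡ true → ⊥
blocked-t2-s1'-s2' {X} {Y} {Q} XY XQ YQ endsX x₁∈ endsY x₂∈ endsQ z∈ =
  cut-overloaded upper-left upper-left-cut {X} {Y} {Q} (disjoint XY) (disjoint XQ) (disjoint YQ)
    (trans (parity-ends upper-left endsX) (S12⊆upper-left _ x₁∈))
    (trans (parity-ends upper-left endsY) (S12⊆upper-left _ x₂∈))
    (trans (parity-ends upper-left endsQ) (T'-outside-upper-left _ z∈))
    u5-u7∈Q refl
  where
  X° : ∀ {v} → v ≢ s1' → S12 v ≡ false → Internal X v
  X° v≢s1' v∉ = internal endsX v≢s1' (separated S12 v∉ x₁∈)

  Y° : ∀ {v} → v ≢ s2' → S12 v ≡ false → Internal Y v
  Y° v≢s2' v∉ = internal endsY v≢s2' (separated S12 v∉ x₂∈)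

  Q° : ∀ {v} → v ≢ t2 → T' v ≡ false → Internal Q v
  Q° v≢t2 v∉ = internal endsQ v≢t2 (separated T' v∉ z∈)

  at-u9 : u9-u10 ∈ edges X × u7-u9 ∈ edges Q
  at-u9 = uncrossed-exits star-u9 XQ (ordinary u9)
            (X° (λ ()) refl) (Q° (λ ()) refl)
            (pendant-∈ endsX (edgesAt _ _)) (pendant-∈ endsQ (edgesAt _ _))

  u7-u10∈X : u7-u10 ∈ edges X
  u7-u10∈X = proj₁ (uncrossed-exits star-u10 XY (ordinary u10)
               (X° (λ ()) refl) (Y° (λ ()) refl)
               (proj₁ at-u9) (pendant-∈ endsY (edgesAt _ _)))

  u5-u7∈Q : u5-u7 ∈ edges Q
  u5-u7∈Q = proj₂ (uncrossed-exits star-u7 XQ (ordinary u7)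
              (X° (λ ()) refl) (Q° (λ ()) refl)
              u7-u10∈X (proj₂ at-u9))

blocked-t1 : ∀ {X Y Q x₁ y₁ x₂ y₂ z} → Compatible X Y → Compatible X Q → Compatible Y Q →
             Ends X x₁ y₁ → S12 x₁ ≡ true → S'' left y₁ ≡ true →
             Ends Y x₂ y₂ → S12 x₂ ≡ true → S'' left y₂ ≡ true →
             Ends Q t1 z → T' z ≡ true → ⊥
blocked-t1 XY XQ YQ endsX x₁∈ y₁∈ endsY x₂∈ y₂∈ endsQ z∈
  with S12-cases _ x₁∈ | S12-cases _ x₂∈
... | inj₁ refl | inj₁ refl =
  disjoint XY s1-u1 (pendant-∈ endsX (edgesAt _ _)) (pendant-∈ endsY (edgesAt _ _))
... | inj₂ refl | inj₂ refl =
  disjoint XY s2-u2 (pendant-∈ endsX (edgesAt _ _)) (pendant-∈ endsY (edgesAt _ _))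
... | inj₁ refl | inj₂ refl = blocked-t1-s1-s2 XY XQ YQ endsX y₁∈ endsY y₂∈ endsQ z∈
... | inj₂ refl | inj₁ refl =
  blocked-t1-s1-s2 (compatible-sym XY) YQ XQ endsY y₂∈ endsX y₁∈ endsQ z∈

blocked-t2 : ∀ {X Y Q x₁ y₁ x₂ y₂ z} → Compatible X Y → Compatible X Q → Compatible Y Q →
             Ends X x₁ y₁ → S12 x₁ ≡ true → S'' left y₁ ≡ true →
             Ends Y x₂ y₂ → S12 x₂ ≡ true → S'' left y₂ ≡ true →
             Ends Q t2 z → T' z ≡ true → ⊥
blocked-t2 XY XQ YQ endsX x₁∈ y₁∈ endsY x₂∈ y₂∈ endsQ z∈
  with S''-left-cases _ y₁∈ | S''-left-cases _ y₂∈
... | inj₁ refl | inj₁ refl =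
  disjoint XY s1'-u9 (pendant-∈ (ends-sym endsX) (edgesAt _ _))
                     (pendant-∈ (ends-sym endsY) (edgesAt _ _))
... | inj₂ refl | inj₂ refl =
  disjoint XY s2'-u10 (pendant-∈ (ends-sym endsX) (edgesAt _ _))
                      (pendant-∈ (ends-sym endsY) (edgesAt _ _))
... | inj₁ refl | inj₂ refl =
  blocked-t2-s1'-s2' XY XQ YQ (ends-sym endsX) x₁∈ (ends-sym endsY) x₂∈ endsQ z∈
... | inj₂ refl | inj₁ refl =
  blocked-t2-s1'-s2' (compatible-sym XY) YQ XQ
    (ends-sym endsY) x₂∈ (ends-sym endsX) x₁∈ endsQ z∈

no-left-routing : ∀ {X Y Q} → Compatible X Y → Compatible X Q → Compatible Y Q →
                  isXYPath S12 (S'' left) X ≡ true → isXYPath S12 (S'' left) Y ≡ true →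
                  isXYPath T T' Q ≡ true → ⊥
no-left-routing XY XQ YQ xyX xyY xyQ with xy-ends xyX | xy-ends xyY | xy-ends xyQ
... | _ , _ , x₁∈ , y₁∈ , endsX | _ , _ , x₂∈ , y₂∈ , endsY | t , _ , t∈ , z∈ , endsQ
  with T-cases t t∈
...   | inj₁ refl = blocked-t1 XY XQ YQ endsX x₁∈ y₁∈ endsY x₂∈ y₂∈ endsQ z∈
...   | inj₂ refl = blocked-t2 XY XQ YQ endsX x₁∈ y₁∈ endsY x₂∈ y₂∈ endsQ z∈

not-both : ∀ R → isXYPath S12 (S'' left) R ≡ true → isXYPath T T' R ≡ true → ⊥
not-both R xy tt′ with trans (sym (cong₂ _∧_ xy tt′)) (no-pair-is-both (start R) (end R))
... | ()

lemma5 : (P : Fin 3 → Path) →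
    (∀ i j → i ≢ j → EdgeDisjoint (P i) (P j)) →
    (∀ i j → i ≢ j → ∀ v → ¬ CrossingVertex v → ¬ CrossAt (P i) (P j) v) →
    (side : Side) →
    countXY S12 (S'' side) P ≡ 2 →
    countXY T T' P ≡ 1 →
    side ≡ right
lemma5 P edge-disjoint non-crossing right _   _   = refl
lemma5 P edge-disjoint non-crossing left  two one =
  ⊥-elim (no-left-routing (compatible i j i≢j) (compatible i k i≢k) (compatible j k j≢k)
                          p-i p-j q-k)
  where
  open TwoAndOne (two-and-one (λ i → isXYPath S12 (S'' left) (P i)) (λ i → isXYPath T T' (P i))
                              two one (λ i → not-both (P i)))

  compatible : ∀ i j → i ≢ j → Compatible (P i) (P j)
  compatible i j i≢j = record
    { disjoint   = edge-disjoint i j i≢j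
    ; uncrossed  = non-crossing i j i≢j
    ; uncrossed′ = non-crossing j i (i≢j ∘ sym) }
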